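{- Let $m\ge 2$ be an integer, let $h_{m-1}=\sum_{r=1}^{m-1}\frac1r$, and define $a_j=a_{m-1,j}$ for $0\le j\le m-1$ by \[ \prod_{r=1}^{m-1}\left(1+\frac{x}{r}\right)=\sum_{j=0}^{m-1}a_j x^j \] (equivalently, $a_j$ is the $j$-th elementary symmetric function of $1,\frac12,\dots,\frac1{m-1}$). Then \[ \frac{a_j}{a_{j-1}}\ \ge\ \frac{h_{m-1}-1}{j} \] for every integer $j$ with $1\le j\le h_{m-1}/2$. -}

module Defs where

open import Data.Nat using (ℕ; zero; suc)
open import Data.Integer using (+_)
open import Data.Rational using (ℚ; 0ℚ; 1ℚ; _+_; _*_; _/_)

harmonic : ℕ → ℚ
harmonic zero    = 0ℚ
harmonic (suc n) = harmonic n + (+ 1 / suc n)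

-- coeff n j = coefficient of x^j in  ∏_{r=1}^{n} (1 + x/r)
-- (the j-th elementary symmetric function of 1, 1/2, …, 1/n).
-- Computed by multiplying the product for n by the factor (1 + x/(n+1)).
coeff : ℕ → ℕ → ℚ
coeff zero    zero    = 1ℚ
coeff zero    (suc j) = 0ℚ
coeff (suc n) zero    = coeff n zero
coeff (suc n) (suc j) = coeff n (suc j) + coeff n j * (+ 1 / suc n)

module Submission where

-- Write e_j = coeff n j for the j-th elementary symmetric function of
-- 1, 1/2, …, 1/n, h = harmonic n and s = Σ_{r ≤ n} 1/r².  The theorem is
-- a rearrangement of the bound  D_k ≤ e_k  for the Newton defect
--     D_j = h e_j − (j+1) e_{j+1}.
-- Newton's identities give (j+1) e_{j+1} = h e_j − s e_{j−1} + (terms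
-- alternating in sign and decreasing), so D_0 = 0 and D_{j+1} ≤ s e_j;
-- we prove this directly by induction on n from the recurrence
--     e'_{j+1} = e_{j+1} + e_j / (n+1).
-- Telescoping 1/(r+1)² ≤ 1/r − 1/(r+1) gives s ≤ 2.  Then D_k ≤ e_k
-- follows by induction on k: the case k−1 is equivalent to
-- (h−1) e_{k−1} ≤ k e_k, and for k+1 ≤ h/2 we have k·s ≤ 2k ≤ h − 1, so
--     D_k ≤ s e_{k−1} ≤ (h−1) e_{k−1} / k ≤ e_k.

open import Defs
open import Level using (0ℓ)
open import Data.Nat using (ℕ; zero; suc; _∸_) renaming (_≤_ to _≤ℕ_)
import Data.Nat as ℕ
import Data.Nat.Properties as ℕ
import Data.Nat.Coprimality as C
open import Data.Integer using (+_)
open import Data.Rational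
  using (ℚ; mkℚ; 0ℚ; 1ℚ; ½; _+_; _*_; _-_; -_; _/_; 1/_; _≤_; _≟_; nonNegative)
open import Data.Rational.Properties
open import Relation.Nullary.Decidable.Core using (dec⇒maybe)
open import Tactic.RingSolver using (solve-∀)
open import Tactic.RingSolver.Core.AlmostCommutativeRing
  using (AlmostCommutativeRing; fromCommutativeRing)
open import Relation.Binary.PropositionalEquality
  using (_≡_; refl; sym; trans; cong; cong₂; subst; module ≡-Reasoning)

ℚ-ring : AlmostCommutativeRing 0ℓ 0ℓ
ℚ-ring = fromCommutativeRing +-*-commutativeRing (λ x → dec⇒maybe (0ℚ ≟ x))

sucℚ : ℕ → ℚ
sucℚ j = + suc j / 1

recip : ℕ → ℚ
recip n = + 1 / suc n

harmonic₂ : ℕ → ℚ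
harmonic₂ zero    = 0ℚ
harmonic₂ (suc n) = harmonic₂ n + recip n * recip n

defect : ℕ → ℕ → ℚ
defect n j = harmonic n * coeff n j - sucℚ j * coeff n (suc j)

-- Both numbers are already in lowest terms, so they are definitionally the
-- reciprocal of each other in normal form.
sucℚ-normal : ∀ j → sucℚ j ≡ mkℚ (+ suc j) 0 (C.sym (C.1-coprimeTo (suc j)))
sucℚ-normal j = normalize-coprime _

recip-normal : ∀ n → recip n ≡ mkℚ (+ 1) n (C.1-coprimeTo (suc n))
recip-normal n = normalize-coprime _

-- (j+2) = (j+1) + 1: adding 1ℚ to the normal form of j+1 computes to
-- (j+1)·1 + 1 over 1.
sucℚ-suc : ∀ j → sucℚ (suc j) ≡ sucℚ j + 1ℚ
sucℚ-suc j = begin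
  + suc (suc j) / 1           ≡⟨ /-cong (cong +_ (sym numerator)) refl ⟩
  + (suc j ℕ.* 1 ℕ.+ 1) / 1   ≡⟨⟩
  J + 1ℚ                      ≡⟨ cong (_+ 1ℚ) (sym (sucℚ-normal j)) ⟩
  sucℚ j + 1ℚ                 ∎
  where
  open ≡-Reasoning
  J = mkℚ (+ suc j) 0 (C.sym (C.1-coprimeTo (suc j)))
  numerator : suc j ℕ.* 1 ℕ.+ 1 ≡ suc (suc j)
  numerator = trans (ℕ.+-comm (suc j ℕ.* 1) 1) (cong suc (ℕ.*-identityʳ (suc j)))

recip-inverse : ∀ n → recip n * sucℚ n ≡ 1ℚ
recip-inverse n = begin
  recip n * sucℚ n   ≡⟨ cong₂ _*_ (recip-normal n) (sucℚ-normal n) ⟩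
  1/ N * N           ≡⟨ *-inverseˡ N ⟩
  1ℚ                 ∎
  where
  open ≡-Reasoning
  N = mkℚ (+ suc n) 0 (C.sym (C.1-coprimeTo (suc n)))

recip-telescope : ∀ n → recip n ≡ recip (suc n) + recip (suc n) * recip n
recip-telescope n = begin
  z                           ≡⟨ sym (*-identityʳ z) ⟩
  z * 1ℚ                      ≡⟨ cong (z *_) (sym (recip-inverse (suc n))) ⟩
  z * (y * sucℚ (suc n))      ≡⟨ cong (λ t → z * (y * t)) (sucℚ-suc n) ⟩
  z * (y * (sucℚ n + 1ℚ))     ≡⟨ expand y z (sucℚ n) ⟩
  y * (z * sucℚ n) + y * z    ≡⟨ cong (λ t → y * t + y * z) (recip-inverse n) ⟩
  y * 1ℚ + y * z              ≡⟨ cong (_+ y * z) (*-identityʳ y) ⟩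
  y + y * z                   ∎
  where
  open ≡-Reasoning
  z = recip n
  y = recip (suc n)
  expand : ∀ y z c → z * (y * (c + 1ℚ)) ≡ y * (z * c) + y * z
  expand = solve-∀ ℚ-ring

p≤p+q : ∀ p {q} → 0ℚ ≤ q → p ≤ p + q
p≤p+q p {q} 0≤q = subst (_≤ p + q) (+-identityʳ p) (+-monoʳ-≤ p 0≤q)

0≤p+q : ∀ {p q} → 0ℚ ≤ p → 0ℚ ≤ q → 0ℚ ≤ p + q
0≤p+q {p} 0≤p 0≤q = ≤-trans 0≤p (p≤p+q p 0≤q)

*-monoˡ-≤-0≤ : ∀ {p q} r → 0ℚ ≤ r → p ≤ q → r * p ≤ r * q
*-monoˡ-≤-0≤ r 0≤r = *-monoˡ-≤-nonNeg r {{nonNegative 0≤r}}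

*-monoʳ-≤-0≤ : ∀ {p q} r → 0ℚ ≤ r → p ≤ q → p * r ≤ q * r
*-monoʳ-≤-0≤ r 0≤r = *-monoʳ-≤-nonNeg r {{nonNegative 0≤r}}

0≤p*q : ∀ {p q} → 0ℚ ≤ p → 0ℚ ≤ q → 0ℚ ≤ p * q
0≤p*q {p} {q} 0≤p 0≤q = subst (_≤ p * q) (*-zeroʳ p) (*-monoˡ-≤-0≤ p 0≤p 0≤q)

0≤q-p : ∀ {p q} → p ≤ q → 0ℚ ≤ q - p
0≤q-p {p} {q} p≤q = subst (_≤ q - p) (+-inverseʳ p) (+-monoˡ-≤ (- p) p≤q)

0≤1 : 0ℚ ≤ 1ℚ
0≤1 = nonNegative⁻¹ 1ℚ

0≤recip : ∀ n → 0ℚ ≤ recip n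
0≤recip n = nonNegative⁻¹ (recip n) {{normalize-nonNeg 1 (suc n)}}

0≤sucℚ : ∀ j → 0ℚ ≤ sucℚ j
0≤sucℚ j = nonNegative⁻¹ (sucℚ j) {{normalize-nonNeg (suc j) 1}}

0≤coeff : ∀ n j → 0ℚ ≤ coeff n j
0≤coeff zero    zero    = 0≤1
0≤coeff zero    (suc j) = ≤-refl
0≤coeff (suc n) zero    = 0≤coeff n zero
0≤coeff (suc n) (suc j) = 0≤p+q (0≤coeff n (suc j)) (0≤p*q (0≤coeff n j) (0≤recip n))

defect-zero : ∀ n → defect n 0 ≡ 0ℚ
defect-zero zero    = refl
defect-zero (suc n) = trans (step (harmonic n) (recip n) (coeff n 0) (coeff n 1)) (defect-zero n)
  where
  step : ∀ h x a b → (h + x) * a - 1ℚ * (b + a * x) ≡ h * a - 1ℚ * b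
  step = solve-∀ ℚ-ring

defect-suc : ∀ n j → defect (suc n) (suc j)
           ≡ defect n (suc j) + recip n * defect n j + recip n * recip n * coeff n j
defect-suc n j = step (harmonic n) (recip n) (coeff n j) (coeff n (suc j)) (coeff n (suc (suc j)))
                      (sucℚ j) (sucℚ (suc j)) (sucℚ-suc j)
  where
  step : ∀ h x a b c s t → t ≡ s + 1ℚ →
         (h + x) * (b + a * x) - t * (c + b * x)
         ≡ (h * b - t * c) + x * (h * a - s * b) + x * x * a
  step h x a b c s _ refl = expand h x a b c s
    where
    expand : ∀ h x a b c s → (h + x) * (b + a * x) - (s + 1ℚ) * (c + b * x)
           ≡ (h * b - (s + 1ℚ) * c) + x * (h * a - s * b) + x * x * a
    expand = solve-∀ ℚ-ring

defect-bound : ∀ n j → defect n (suc j) ≤ harmonic₂ n * coeff n j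
defect-bound zero j = ≤-reflexive (vanish (sucℚ (suc j)) (coeff 0 j))
  where
  vanish : ∀ t a → 0ℚ * 0ℚ - t * 0ℚ ≡ 0ℚ * a
  vanish = solve-∀ ℚ-ring
defect-bound (suc n) zero = begin
  defect (suc n) 1                         ≡⟨ defect-suc n 0 ⟩
  defect n 1 + x * defect n 0 + x * x * a  ≤⟨ +-monoˡ-≤ (x * x * a) (+-monoˡ-≤ (x * defect n 0) (defect-bound n 0)) ⟩
  s * a + x * defect n 0 + x * x * a       ≡⟨ cong (λ d → s * a + x * d + x * x * a) (defect-zero n) ⟩
  s * a + x * 0ℚ + x * x * a               ≡⟨ collect s x a ⟩
  (s + x * x) * a                          ∎
  where
  open ≤-Reasoning
  x = recip n
  s = harmonic₂ n
  a = coeff n 0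
  collect : ∀ s x a → s * a + x * 0ℚ + x * x * a ≡ (s + x * x) * a
  collect = solve-∀ ℚ-ring
defect-bound (suc n) (suc j) = begin
  defect (suc n) (suc (suc j))                         ≡⟨ defect-suc n (suc j) ⟩
  defect n (suc (suc j)) + x * defect n (suc j) + x * x * b
    ≤⟨ +-monoˡ-≤ (x * x * b) (+-mono-≤ (defect-bound n (suc j))
                                       (*-monoˡ-≤-0≤ x (0≤recip n) (defect-bound n j))) ⟩
  s * b + x * (s * a) + x * x * b                      ≤⟨ p≤p+q _ 0≤x²ax ⟩
  s * b + x * (s * a) + x * x * b + x * x * (a * x)    ≡⟨ collect s x a b ⟩
  (s + x * x) * (b + a * x)                            ∎
  where
  open ≤-Reasoning
  x = recip n
  s = harmonic₂ n
  a = coeff n j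
  b = coeff n (suc j)
  0≤x²ax : 0ℚ ≤ x * x * (a * x)
  0≤x²ax = 0≤p*q (0≤p*q (0≤recip n) (0≤recip n)) (0≤p*q (0≤coeff n j) (0≤recip n))
  collect : ∀ s x a b → s * b + x * (s * a) + x * x * b + x * x * (a * x)
          ≡ (s + x * x) * (b + a * x)
  collect = solve-∀ ℚ-ring

recip-antitone : ∀ n → recip (suc n) ≤ recip n
recip-antitone n = subst (recip (suc n) ≤_) (sym (recip-telescope n))
                         (p≤p+q _ (0≤p*q (0≤recip (suc n)) (0≤recip n)))

-- Telescoping invariant: Σ_{r ≤ n+1} 1/r² + 1/(n+1) ≤ 2, using
-- 1/(n+2)² ≤ 1/((n+1)(n+2)) = 1/(n+1) − 1/(n+2).
harmonic₂-telescope : ∀ n → harmonic₂ (suc n) + recip n ≤ sucℚ 1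
harmonic₂-telescope zero    = ≤-refl
harmonic₂-telescope (suc n) = begin
  (s + y * y) + y    ≤⟨ +-monoˡ-≤ y (+-monoʳ-≤ s (*-monoˡ-≤-0≤ y (0≤recip (suc n)) (recip-antitone n))) ⟩
  (s + y * z) + y    ≡⟨ regroup s y z ⟩
  s + (y + y * z)    ≡⟨ cong (λ t → s + t) (sym (recip-telescope n)) ⟩
  s + z              ≤⟨ harmonic₂-telescope n ⟩
  sucℚ 1             ∎
  where
  open ≤-Reasoning
  s = harmonic₂ (suc n)
  z = recip n
  y = recip (suc n)
  regroup : ∀ s y z → (s + y * z) + y ≡ s + (y + y * z)
  regroup = solve-∀ ℚ-ring

harmonic₂≤2 : ∀ n → harmonic₂ n ≤ sucℚ 1
harmonic₂≤2 zero    = nonNegative⁻¹ (sucℚ 1)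
harmonic₂≤2 (suc n) = ≤-trans (p≤p+q _ (0≤recip n)) (harmonic₂-telescope n)

ratio-from-defect : ∀ h e c e′ → h * e - c * e′ ≤ e → (h - 1ℚ) * e ≤ c * e′
ratio-from-defect h e c e′ D≤e = begin
  (h - 1ℚ) * e                            ≤⟨ p≤p+q _ (0≤q-p D≤e) ⟩
  (h - 1ℚ) * e + (e - (h * e - c * e′))   ≡⟨ cancel h e c e′ ⟩
  c * e′                                  ∎
  where
  open ≤-Reasoning
  cancel : ∀ h e c e′ → (h - 1ℚ) * e + (e - (h * e - c * e′)) ≡ c * e′
  cancel = solve-∀ ℚ-ring

double-below : ∀ c h → c + 1ℚ ≤ h * ½ → c * sucℚ 1 ≤ h - 1ℚ
double-below c h c+1≤h/2 = begin
  c * two                   ≤⟨ p≤p+q _ 0≤1 ⟩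
  c * two + 1ℚ              ≡⟨ shift c ⟩
  (c + 1ℚ) * two - 1ℚ       ≤⟨ +-monoˡ-≤ (- 1ℚ) (*-monoʳ-≤-0≤ two (0≤sucℚ 1) c+1≤h/2) ⟩
  (h * ½) * two - 1ℚ        ≡⟨ cong (_- 1ℚ) halve-double ⟩
  h - 1ℚ                    ∎
  where
  open ≤-Reasoning
  two = sucℚ 1
  -- two is definitionally 1ℚ + 1ℚ, which the ring solver can see.
  shift : ∀ c → c * (1ℚ + 1ℚ) + 1ℚ ≡ (c + 1ℚ) * (1ℚ + 1ℚ) - 1ℚ
  shift = solve-∀ ℚ-ring
  halve-double : (h * ½) * two ≡ h
  halve-double = trans (*-assoc h ½ two) (*-identityʳ h)

-- Main estimate, by induction on k: for k+1 ≤ h/2,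
--   D_k ≤ s e_{k−1} ≤ (h−1) e_{k−1} / k ≤ e_k,
-- the last step being the case k−1 in rearranged form.
defect≤coeff : ∀ n k → sucℚ k ≤ harmonic n * ½ → defect n k ≤ coeff n k
defect≤coeff n zero    _    = subst (_≤ coeff n 0) (sym (defect-zero n)) (0≤coeff n 0)
defect≤coeff n (suc k) k+2≤h/2 = ≤-trans (defect-bound n k) s·a≤b
  where
  h = harmonic n
  s = harmonic₂ n
  c = sucℚ k
  a = coeff n k
  b = coeff n (suc k)
  c+1≤h/2 : c + 1ℚ ≤ h * ½
  c+1≤h/2 = subst (_≤ h * ½) (sucℚ-suc k) k+2≤h/2
  previous : (h - 1ℚ) * a ≤ c * b
  previous = ratio-from-defect h a c b
               (defect≤coeff n k (≤-trans (p≤p+q c 0≤1) c+1≤h/2))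
  c·s≤h-1 : c * s ≤ h - 1ℚ
  c·s≤h-1 = ≤-trans (*-monoˡ-≤-0≤ c (0≤sucℚ k) (harmonic₂≤2 n)) (double-below c h c+1≤h/2)
  s·a≤b : s * a ≤ b
  s·a≤b = *-cancelˡ-≤-pos c {{normalize-pos (suc k) 1}} (begin
    c * (s * a)    ≡⟨ sym (*-assoc c s a) ⟩
    (c * s) * a    ≤⟨ *-monoʳ-≤-0≤ a (0≤coeff n k) c·s≤h-1 ⟩
    (h - 1ℚ) * a   ≤⟨ previous ⟩
    c * b          ∎)
    where open ≤-Reasoning

lemma1 : (m : ℕ) → 2 ≤ℕ m → (k : ℕ) →
         (+ suc k) / 1 ≤ harmonic (m ∸ 1) * ½ →
         (harmonic (m ∸ 1) - 1ℚ) * coeff (m ∸ 1) k ≤ ((+ suc k) / 1) * coeff (m ∸ 1) (suc k)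
lemma1 m _ k k+1≤h/2 =
  ratio-from-defect (harmonic n) (coeff n k) (sucℚ k) (coeff n (suc k))
    (defect≤coeff n k k+1≤h/2)
  where n = m ∸ 1
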